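{- Let $N$ be a primitive non-deficient number, and write $N = p_1^{a_1} p_2^{a_2} \cdots p_k^{a_k}$ with $p_1, \dots, p_k$ distinct primes and $a_i \ge 1$. Suppose that $a_1 \ge 2$. Then $$h(N) < \left(2 - \frac{1}{p_1^{a_1-1} p_2^{a_2} \cdots p_k^{a_k}}\right)\left(1 + \frac{1}{p_1^{a_1} - 1}\right),$$ where $h(N) = \sigma(N)/N$.
   Context: $\sigma(n)$ is the sum of the positive divisors of $n$, and $h(n) = \sigma(n)/n$. A positive integer $n$ is deficient if $\sigma(n) < 2n$; $n$ is primitive non-deficient if $\sigma(n) \ge 2n$ and every proper divisor of $n$ is deficient. -}

module Defs where

open import Data.Nat using (ℕ; zero; suc; _*_; _^_; _<_; _≤_)
open import Data.Nat.Divisibility using (_∣_; _∣?_)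
open import Data.List using (List; []; _∷_; filter; applyUpTo; map)
open import Data.Nat.ListAction using (sum; product)
open import Data.Product using (_×_; _,_; proj₁; proj₂)
open import Data.Integer using (+_)
open import Data.Rational using (ℚ; _/_; 0ℚ)
import Data.Rational as Q

σ : ℕ → ℕ
σ n = sum (filter (λ d → d ∣? n) (applyUpTo suc n))

-- 1/n as a rational, with the convention inv 0 = 0 (only used for n ≠ 0)
inv : ℕ → ℚ
inv zero    = 0ℚ
inv (suc n) = (+ 1) / suc n

h : ℕ → ℚ
h n = ((+ σ n) / 1) Q.* inv n

Deficient : ℕ → Set
Deficient n = 0 < n × σ n < 2 * n

PrimitiveNonDeficient : ℕ → Set
PrimitiveNonDeficient n =
  0 < n × 2 * n ≤ σ n × (∀ d → d ∣ n → d < n → Deficient d)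

primePowProd : List (ℕ × ℕ) → ℕ
primePowProd ps = product (map (λ pa → proj₁ pa ^ proj₂ pa) ps)

-- Write N = p · d with d = p ^ (a − 1) · R; d is a proper divisor of N, hence deficient:
-- σ(d) ≤ 2d − 1.  The divisors of N divisible by p are p times the divisors of d, the others
-- are the divisors of d prime to p; with t their sum, σ(N) = p σ(d) + t.  Iterating this
-- identity along d = p ^ (a − 1) · R gives t (1 + p + ⋯ + p ^ (a − 1)) ≤ σ(d), i.e.
-- t ≤ (p − 1) σ(d) / (p ^ a − 1).  Therefore
--   h(N) = σ(d)/d · (1 + t / (p σ(d))) < σ(d)/d · (1 + 1 / (p ^ a − 1)) ≤ (2 − 1/d) (1 + 1 / (p ^ a − 1)).

module Submission where

open import Defs
open import Data.Nat using (ℕ; _*_; _^_; _≤_; _∸_)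
open import Data.Nat.Primality using (Prime)
open import Data.List using (List; _∷_; map)
open import Data.List.Relation.Unary.All using (All)
open import Data.List.Relation.Unary.Unique.Propositional using (Unique)
open import Data.Product using (_×_; proj₁; proj₂)
open import Relation.Binary.PropositionalEquality using (_≡_)
open import Data.Integer using (+_)
open import Data.Rational using (ℚ; _/_)
import Data.Rational as Q

open import Data.Nat using (zero; suc; _+_; _<_; pred; s≤s; z<s; s<s; NonZero; >-nonZero; nonTrivial⇒n>1)
open import Data.Nat.Properties
open import Data.Nat.Divisibility
open import Data.Nat.Coprimality using (Coprime; coprime-divisor)
open import Data.Nat.Primality using (prime⇒irreducible; prime⇒nonZero; prime⇒nonTrivial)
open import Data.Nat.ListAction using (sum)
open import Data.List using ([]; filter; applyUpTo)
open import Data.List.Properties using (map-applyUpTo)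
open import Data.Sum using (inj₁; inj₂)
open import Data.Product using (_,_)
open import Function using (_∘_)
open import Relation.Nullary using (Dec; yes; no; ¬_; contradiction)
open import Relation.Unary using (Pred; Decidable)
open import Relation.Binary.PropositionalEquality using (refl; sym; trans; cong; cong₂; subst; module ≡-Reasoning)
open import Data.Nat.Tactic.RingSolver using (solve-∀)
import Data.Integer as ℤ
import Data.Rational.Properties as QP
open import Data.Rational.Unnormalised as U using (mkℚᵘ; *<*)
import Data.Rational.Unnormalised.Properties as UP
import Algebra.Properties.CommutativeSemigroup +-commutativeSemigroup as +-CS
import Algebra.Properties.CommutativeSemigroup *-commutativeSemigroup as *-CS

∑< : ℕ → (ℕ → ℕ) → ℕ
∑< m f = sum (applyUpTo f m)

syntax ∑< m (λ i → f) = ∑[ i < m ] f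

∑-cong : ∀ m {f g : ℕ → ℕ} → (∀ i → i < m → f i ≡ g i) → ∑< m f ≡ ∑< m g
∑-cong zero    f≡g = refl
∑-cong (suc m) f≡g = cong₂ _+_ (f≡g 0 z<s) (∑-cong m (λ i i<m → f≡g (suc i) (s<s i<m)))

∑-zero : ∀ m {f : ℕ → ℕ} → (∀ i → i < m → f i ≡ 0) → ∑< m f ≡ 0
∑-zero zero    f≡0 = refl
∑-zero (suc m) f≡0 = cong₂ _+_ (f≡0 0 z<s) (∑-zero m (λ i i<m → f≡0 (suc i) (s<s i<m)))

∑-distrib-+ : ∀ m (f g : ℕ → ℕ) → ∑[ i < m ] (f i + g i) ≡ ∑< m f + ∑< m g
∑-distrib-+ zero    f g = refl
∑-distrib-+ (suc m) f g = trans (cong (_+_ (f 0 + g 0)) (∑-distrib-+ m (f ∘ suc) (g ∘ suc)))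
                                (+-CS.interchange (f 0) (g 0) (∑< m (f ∘ suc)) (∑< m (g ∘ suc)))

∑-distribˡ-* : ∀ m c (f : ℕ → ℕ) → ∑[ i < m ] (c * f i) ≡ c * ∑< m f
∑-distribˡ-* zero    c f = sym (*-zeroʳ c)
∑-distribˡ-* (suc m) c f = trans (cong (_+_ (c * f 0)) (∑-distribˡ-* m c (f ∘ suc)))
                                 (sym (*-distribˡ-+ c (f 0) _))

∑-split : ∀ a b (f : ℕ → ℕ) → ∑< (a + b) f ≡ ∑< a f + ∑[ i < b ] f (a + i)
∑-split zero    b f = refl
∑-split (suc a) b f = trans (cong (_+_ (f 0)) (∑-split a b (f ∘ suc))) (sym (+-assoc (f 0) _ _))

∑-last : ∀ m (f : ℕ → ℕ) → ∑< (suc m) f ≡ ∑< m f + f m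
∑-last zero    f = +-identityʳ (f 0)
∑-last (suc m) f = trans (cong (_+_ (f 0)) (∑-last m (f ∘ suc))) (sym (+-assoc (f 0) _ _))

∑-extend : ∀ {m l} (f : ℕ → ℕ) → m ≤ l → (∀ i → m ≤ i → f i ≡ 0) → ∑< l f ≡ ∑< m f
∑-extend {m} {l} f m≤l f≡0 = begin
  ∑< l f                              ≡⟨ cong (λ k → ∑< k f) (m+[n∸m]≡n m≤l) ⟨
  ∑< (m + (l ∸ m)) f                  ≡⟨ ∑-split m (l ∸ m) f ⟩
  ∑< m f + ∑[ i < l ∸ m ] f (m + i)   ≡⟨ cong (_+_ (∑< m f)) (∑-zero (l ∸ m) tail≡0) ⟩
  ∑< m f + 0                          ≡⟨ +-identityʳ _ ⟩
  ∑< m f                              ∎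
  where
  open ≡-Reasoning
  tail≡0 : ∀ i → i < l ∸ m → f (m + i) ≡ 0
  tail≡0 i _ = f≡0 (m + i) (m≤m+n m i)

suc[m*n+pred[n]]≡[1+m]*n : ∀ m n .{{_ : NonZero n}} → suc (m * n + pred n) ≡ suc m * n
suc[m*n+pred[n]]≡[1+m]*n m (suc k) = trans (sym (+-suc (m * suc k) k)) (+-comm (m * suc k) (suc k))

-- Index i stands for the number suc i, so the multiples of p sit at the indices j * p + pred p.
∑-multiples : ∀ p .{{_ : NonZero p}} n (f : ℕ → ℕ) → (∀ i → p ∤ suc i → f i ≡ 0) →
              ∑< (n * p) f ≡ ∑[ j < n ] f (j * p + pred p)
∑-multiples p       zero    f f≡0 = refl
∑-multiples (suc k) (suc n) f f≡0 = begin
  ∑< (suc k + n * suc k) f                             ≡⟨ ∑-split (suc k) (n * suc k) f ⟩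
  ∑< (suc k) f + ∑[ i < n * suc k ] f (suc k + i)      ≡⟨ cong₂ _+_ firstBlock laterBlocks ⟩
  f k + ∑[ j < n ] f (suc j * suc k + k)               ∎
  where
  open ≡-Reasoning
  firstBlock : ∑< (suc k) f ≡ f k
  firstBlock = trans (∑-last k f) (cong (_+ f k) (∑-zero k (λ i i<k →
    f≡0 i (λ k+1∣i+1 → <⇒≱ (s<s i<k) (∣⇒≤ k+1∣i+1)))))
  laterBlocks : ∑[ i < n * suc k ] f (suc k + i) ≡ ∑[ j < n ] f (suc j * suc k + k)
  laterBlocks = trans
    (∑-multiples (suc k) n (λ i → f (suc k + i)) (λ i k+1∤ → f≡0 (suc k + i)
      (λ k+1∣ → k+1∤ (∣m+n∣m⇒∣n (subst (suc k ∣_) (sym (+-suc (suc k) i)) k+1∣) ∣-refl))))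
    (∑-cong n (λ j _ → cong f (sym (+-assoc (suc k) (j * suc k) k))))

keepIf : {P : Set} → Dec P → ℕ → ℕ
keepIf (yes _) x = x
keepIf (no _)  _ = 0

dropIf : {P : Set} → Dec P → ℕ → ℕ
dropIf (yes _) _ = 0
dropIf (no _)  x = x

keepIf-yes : {P : Set} (P? : Dec P) {x : ℕ} → P → keepIf P? x ≡ x
keepIf-yes (yes _) _ = refl
keepIf-yes (no ¬p) p = contradiction p ¬p

keepIf-no : {P : Set} (P? : Dec P) {x : ℕ} → ¬ P → keepIf P? x ≡ 0
keepIf-no (yes p) ¬p = contradiction p ¬p
keepIf-no (no _)  _  = refl

dropIf-zero : {P : Set} (P? : Dec P) → dropIf P? 0 ≡ 0
dropIf-zero (yes _) = refl
dropIf-zero (no _)  = refl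

keepIf+dropIf : {P : Set} (P? : Dec P) (x : ℕ) → keepIf P? x + dropIf P? x ≡ x
keepIf+dropIf (yes _) x = +-identityʳ x
keepIf+dropIf (no _)  x = refl

sum-filter : {P : Pred ℕ _} (P? : Decidable P) (xs : List ℕ) →
             sum (filter P? xs) ≡ sum (map (λ x → keepIf (P? x) x) xs)
sum-filter P? []       = refl
sum-filter P? (x ∷ xs) with P? x
... | yes _ = cong (_+_ x) (sum-filter P? xs)
... | no  _ = sum-filter P? xs

divisorTerm : ℕ → ℕ → ℕ
divisorTerm n i = keepIf (suc i ∣? n) (suc i)

σ≡∑divisorTerm : ∀ n → σ n ≡ ∑[ i < n ] divisorTerm n i
σ≡∑divisorTerm n = trans (sum-filter (_∣? n) (applyUpTo suc n)) (cong sum (map-applyUpTo suc _ n))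

σ∣ : ℕ → ℕ → ℕ
σ∣ p n = ∑[ i < n ] keepIf (p ∣? suc i) (divisorTerm n i)

σ∤ : ℕ → ℕ → ℕ
σ∤ p n = ∑[ i < n ] dropIf (p ∣? suc i) (divisorTerm n i)

σ≡σ∣+σ∤ : ∀ p n → σ n ≡ σ∣ p n + σ∤ p n
σ≡σ∣+σ∤ p n = begin
  σ n                                                       ≡⟨ σ≡∑divisorTerm n ⟩
  ∑[ i < n ] divisorTerm n i                                ≡⟨ ∑-cong n (λ i _ → split i) ⟩
  ∑[ i < n ] (keepIf (p ∣? suc i) (divisorTerm n i)
              + dropIf (p ∣? suc i) (divisorTerm n i))      ≡⟨ ∑-distrib-+ n _ _ ⟩
  σ∣ p n + σ∤ p n                                           ∎
  where
  open ≡-Reasoning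
  split : ∀ i → divisorTerm n i ≡ keepIf (p ∣? suc i) (divisorTerm n i) + dropIf (p ∣? suc i) (divisorTerm n i)
  split i = sym (keepIf+dropIf (p ∣? suc i) (divisorTerm n i))

σ∤≤σ : ∀ p n → σ∤ p n ≤ σ n
σ∤≤σ p n = subst (σ∤ p n ≤_) (sym (σ≡σ∣+σ∤ p n)) (m≤n+m (σ∤ p n) (σ∣ p n))

σ>0 : ∀ n .{{_ : NonZero n}} → 0 < σ n
σ>0 (suc m) = subst (0 <_) (sym (σ≡∑divisorTerm (suc m)))
  (<-≤-trans (subst (0 <_) (sym (keepIf-yes (1 ∣? suc m) (1∣ suc m))) z<s) (m≤m+n _ _))

divisorTerm-beyond : ∀ n .{{_ : NonZero n}} i → n ≤ i → divisorTerm n i ≡ 0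
divisorTerm-beyond n i n≤i = keepIf-no (suc i ∣? n) (λ i+1∣n → <⇒≱ (s≤s n≤i) (∣⇒≤ i+1∣n))

keepIf-∣-* : ∀ p .{{_ : NonZero p}} x n → keepIf (x * p ∣? p * n) (x * p) ≡ p * keepIf (x ∣? n) x
keepIf-∣-* p x n with x * p ∣? p * n | x ∣? n
... | yes _     | yes _   = *-comm x p
... | no  _     | no  _   = sym (*-zeroʳ p)
... | yes xp∣pn | no  x∤n = contradiction (*-cancelˡ-∣ p (subst (_∣ p * n) (*-comm x p) xp∣pn)) x∤n
... | no  xp∤pn | yes x∣n = contradiction (subst (_∣ p * n) (*-comm p x) (*-monoʳ-∣ p x∣n)) xp∤pn

divisorTerm-multiple : ∀ p .{{_ : NonZero p}} n j →
                       divisorTerm (p * n) (j * p + pred p) ≡ p * divisorTerm n j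
divisorTerm-multiple p n j =
  trans (cong (λ x → keepIf (x ∣? p * n) x) (suc[m*n+pred[n]]≡[1+m]*n j p)) (keepIf-∣-* p (suc j) n)

σ∣-* : ∀ p .{{_ : NonZero p}} n → σ∣ p (p * n) ≡ p * σ n
σ∣-* p n = begin
  ∑< (p * n) f                          ≡⟨ cong (λ m → ∑< m f) (*-comm p n) ⟩
  ∑< (n * p) f                          ≡⟨ ∑-multiples p n f (λ i → keepIf-no (p ∣? suc i)) ⟩
  ∑[ j < n ] f (j * p + pred p)         ≡⟨ ∑-cong n (λ j _ → atMultiple j) ⟩
  ∑[ j < n ] (p * divisorTerm n j)      ≡⟨ ∑-distribˡ-* n p (divisorTerm n) ⟩
  p * ∑[ j < n ] divisorTerm n j        ≡⟨ cong (p *_) (sym (σ≡∑divisorTerm n)) ⟩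
  p * σ n                               ∎
  where
  open ≡-Reasoning
  f : ℕ → ℕ
  f i = keepIf (p ∣? suc i) (divisorTerm (p * n) i)
  atMultiple : ∀ j → f (j * p + pred p) ≡ p * divisorTerm n j
  atMultiple j = trans (keepIf-yes (p ∣? _) p∣) (divisorTerm-multiple p n j)
    where
    p∣ : p ∣ suc (j * p + pred p)
    p∣ = subst (p ∣_) (sym (suc[m*n+pred[n]]≡[1+m]*n j p)) (n∣m*n (suc j))

prime∤⇒coprime : ∀ {p x} → Prime p → p ∤ x → Coprime x p
prime∤⇒coprime p-prime p∤x (d∣x , d∣p) with prime⇒irreducible p-prime d∣p
... | inj₁ d≡1 = d≡1
... | inj₂ refl = contradiction d∣x p∤x

dropIf-divisorTerm-* : ∀ {p} → Prime p → ∀ n i →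
  dropIf (p ∣? suc i) (divisorTerm (p * n) i) ≡ dropIf (p ∣? suc i) (divisorTerm n i)
dropIf-divisorTerm-* {p} p-prime n i with p ∣? suc i
... | yes _ = refl
... | no p∤i+1 with suc i ∣? p * n | suc i ∣? n
...   | yes _      | yes _     = refl
...   | no  _      | no  _     = refl
...   | yes i+1∣pn | no  i+1∤n =
  contradiction (coprime-divisor (prime∤⇒coprime p-prime p∤i+1) i+1∣pn) i+1∤n
...   | no  i+1∤pn | yes i+1∣n = contradiction (∣-trans i+1∣n (n∣m*n p)) i+1∤pn

σ∤-* : ∀ {p} → Prime p → ∀ n .{{_ : NonZero n}} → σ∤ p (p * n) ≡ σ∤ p n
σ∤-* {p} p-prime n = begin
  σ∤ p (p * n)
    ≡⟨ ∑-cong (p * n) (λ i _ → dropIf-divisorTerm-* p-prime n i) ⟩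
  ∑[ i < p * n ] dropIf (p ∣? suc i) (divisorTerm n i)
    ≡⟨ ∑-extend _ (m≤n*m n p {{prime⇒nonZero p-prime}}) beyond ⟩
  σ∤ p n
    ∎
  where
  open ≡-Reasoning
  beyond : ∀ i → n ≤ i → dropIf (p ∣? suc i) (divisorTerm n i) ≡ 0
  beyond i n≤i =
    trans (cong (dropIf (p ∣? suc i)) (divisorTerm-beyond n i n≤i)) (dropIf-zero (p ∣? suc i))

σ-* : ∀ {p} → Prime p → ∀ n .{{_ : NonZero n}} → σ (p * n) ≡ p * σ n + σ∤ p n
σ-* {p} p-prime n = begin
  σ (p * n)                       ≡⟨ σ≡σ∣+σ∤ p (p * n) ⟩
  σ∣ p (p * n) + σ∤ p (p * n)     ≡⟨ cong₂ _+_ (σ∣-* p {{prime⇒nonZero p-prime}} n) (σ∤-* p-prime n) ⟩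
  p * σ n + σ∤ p n                ∎
  where open ≡-Reasoning

repunit : ℕ → ℕ → ℕ
repunit p zero    = 1
repunit p (suc k) = 1 + p * repunit p k

repunit≢0 : ∀ p k → NonZero (repunit p k)
repunit≢0 p zero    = _
repunit≢0 p (suc k) = _

repunit-geometric : ∀ p k → p * repunit (suc p) k + 1 ≡ suc p ^ suc k
repunit-geometric p zero    = +-comm (p * 1) 1
repunit-geometric p (suc k) =
  trans (step p (repunit (suc p) k)) (cong (suc p *_) (repunit-geometric p k))
  where
  step : ∀ p g → p * (1 + (1 + p) * g) + 1 ≡ (1 + p) * (p * g + 1)
  step = solve-∀

σ∤*repunit≤σ : ∀ {p} → Prime p → ∀ k n .{{_ : NonZero n}} →
               σ∤ p (p ^ k * n) * repunit p k ≤ σ (p ^ k * n)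
σ∤*repunit≤σ {p} p-prime zero    n = subst (_≤ σ (1 * n)) (sym (*-identityʳ _)) (σ∤≤σ p (1 * n))
σ∤*repunit≤σ {p} p-prime (suc k) n = begin
  σ∤ p (p ^ suc k * n) * repunit p (suc k)    ≡⟨ cong (λ x → σ∤ p x * repunit p (suc k)) (*-assoc p (p ^ k) n) ⟩
  σ∤ p (p * m) * (1 + p * repunit p k)        ≡⟨ cong (_* (1 + p * repunit p k)) (σ∤-* p-prime m) ⟩
  σ∤ p m * (1 + p * repunit p k)              ≡⟨ distribute (σ∤ p m) p (repunit p k) ⟩
  σ∤ p m + p * (σ∤ p m * repunit p k)         ≤⟨ +-monoʳ-≤ (σ∤ p m) (*-monoʳ-≤ p IH) ⟩
  σ∤ p m + p * σ m                            ≡⟨ +-comm (σ∤ p m) (p * σ m) ⟩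
  p * σ m + σ∤ p m                            ≡⟨ sym (σ-* p-prime m) ⟩
  σ (p * m)                                   ≡⟨ cong σ (*-assoc p (p ^ k) n) ⟨
  σ (p ^ suc k * n)                           ∎
  where
  open ≤-Reasoning
  IH : σ∤ p (p ^ k * n) * repunit p k ≤ σ (p ^ k * n)
  IH = σ∤*repunit≤σ p-prime k n
  m : ℕ
  m = p ^ k * n
  instance
    m≢0 : NonZero m
    m≢0 = m*n≢0 (p ^ k) n {{m^n≢0 p k {{prime⇒nonZero p-prime}}}}
  distribute : ∀ t p g → t * (1 + p * g) ≡ t + p * (t * g)
  distribute = solve-∀

cross-multiplied-bound : ∀ p s t g c → t * g ≤ s → 0 < s → s ≤ c →
                         (suc p * s + t) * (p * g) < c * suc (p * g) * suc p
cross-multiplied-bound p s t g c t*g≤s s>0 s≤c = begin-strict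
  (suc p * s + t) * q           ≡⟨ *-distribʳ-+ q (suc p * s) t ⟩
  suc p * s * q + t * q         <⟨ +-monoʳ-< (suc p * s * q) t*q<[1+p]*s ⟩
  suc p * s * q + suc p * s     ≡⟨ +-comm (suc p * s * q) (suc p * s) ⟩
  suc p * s + suc p * s * q     ≡⟨ *-suc (suc p * s) q ⟨
  suc p * s * suc q             ≤⟨ *-monoˡ-≤ (suc q) (*-monoʳ-≤ (suc p) s≤c) ⟩
  suc p * c * suc q             ≡⟨ *-CS.xy∙z≈yz∙x (suc p) c (suc q) ⟩
  c * suc q * suc p             ∎
  where
  open ≤-Reasoning
  q : ℕ
  q = p * g
  t*q<[1+p]*s : t * q < suc p * s
  t*q<[1+p]*s = begin-strict
    t * (p * g)    ≡⟨ *-CS.x∙yz≈y∙xz t p g ⟩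
    p * (t * g)    ≤⟨ *-monoʳ-≤ p t*g≤s ⟩
    p * s          <⟨ *-monoˡ-< s {{>-nonZero s>0}} (n<1+n p) ⟩
    suc p * s      ∎

<-resp-≡ : ∀ {a b c d} → a < b → a ≡ c → b ≡ d → c < d
<-resp-≡ a<b refl refl = a<b

-- The cross-multiplied sides of the comparison in ℚᵘ-cross-multiply, in the normal form Agda
-- computes for them; it only reaches that form once S and e are split into zero and suc.
numerator-lhs : ∀ S E r → suc S * suc E * suc r
                        ≡ suc (r + 0 + (E + 0) * suc (r + 0) + S * 1 * suc (r + 0 + (E + 0) * suc (r + 0)))
numerator-lhs = solve-∀

numerator-rhs : ∀ F r n → suc F * suc (suc r) * suc n
                        ≡ suc (n + 0 + (r + 0 + 1 + F * suc (r + 0 + 1)) * suc (n + 0))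
numerator-rhs = solve-∀

ℚᵘ-cross-multiply : ∀ S n e r → S * suc e * suc r < (2 * suc e ∸ 1) * suc (suc r) * suc n →
  mkℚᵘ (+ S) 0 U.* mkℚᵘ (+ 1) n
    U.< (mkℚᵘ (+ 2) 0 U.+ U.- mkℚᵘ (+ 1) e) U.* (mkℚᵘ (+ 1) 0 U.+ mkℚᵘ (+ 1) r)
ℚᵘ-cross-multiply zero    n zero    r _  = *<* (ℤ.+<+ z<s)
ℚᵘ-cross-multiply zero    n (suc e) r _  = *<* (ℤ.+<+ z<s)
ℚᵘ-cross-multiply (suc S) n zero    r lt =
  *<* (ℤ.+<+ (<-resp-≡ lt (numerator-lhs S 0 r) (numerator-rhs 0 r n)))
ℚᵘ-cross-multiply (suc S) n (suc e) r lt =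
  *<* (ℤ.+<+ (<-resp-≡ lt (numerator-lhs S (suc e) r) (numerator-rhs (e + 1 * suc (suc e)) r n)))

ratio<bound : ∀ S n e r .{{_ : NonZero n}} .{{_ : NonZero e}} .{{_ : NonZero r}} →
  S * e * r < (2 * e ∸ 1) * suc r * n →
  (+ S) / 1 Q.* inv n Q.< ((+ 2) / 1 Q.- inv e) Q.* ((+ 1) / 1 Q.+ inv r)
ratio<bound S (suc n) (suc e) (suc r) lt =
  QP.toℚᵘ-cancel-< (UP.<-respˡ-≃ (UP.≃-sym lhs) (UP.<-respʳ-≃ (UP.≃-sym rhs) (ℚᵘ-cross-multiply S n e r lt)))
  where
  [_/1+_] : ∀ i d → Q.toℚᵘ (i / suc d) U.≃ mkℚᵘ i d
  [ i /1+ d ] = QP.toℚᵘ-fromℚᵘ (mkℚᵘ i d)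
  lhs : Q.toℚᵘ ((+ S) / 1 Q.* inv (suc n)) U.≃ mkℚᵘ (+ S) 0 U.* mkℚᵘ (+ 1) n
  lhs = UP.≃-trans (QP.toℚᵘ-homo-* ((+ S) / 1) (inv (suc n))) (UP.*-cong [ + S /1+ 0 ] [ + 1 /1+ n ])
  2-1/e : Q.toℚᵘ ((+ 2) / 1 Q.- inv (suc e)) U.≃ mkℚᵘ (+ 2) 0 U.+ U.- mkℚᵘ (+ 1) e
  2-1/e = UP.≃-trans (QP.toℚᵘ-homo-+ ((+ 2) / 1) (Q.- inv (suc e)))
    (UP.+-cong [ + 2 /1+ 0 ] (UP.≃-trans (QP.toℚᵘ-homo‿- (inv (suc e))) (UP.-‿cong [ + 1 /1+ e ])))
  1+1/r : Q.toℚᵘ ((+ 1) / 1 Q.+ inv (suc r)) U.≃ mkℚᵘ (+ 1) 0 U.+ mkℚᵘ (+ 1) r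
  1+1/r = UP.≃-trans (QP.toℚᵘ-homo-+ ((+ 1) / 1) (inv (suc r))) (UP.+-cong [ + 1 /1+ 0 ] [ + 1 /1+ r ])
  rhs : Q.toℚᵘ (((+ 2) / 1 Q.- inv (suc e)) Q.* ((+ 1) / 1 Q.+ inv (suc r)))
        U.≃ (mkℚᵘ (+ 2) 0 U.+ U.- mkℚᵘ (+ 1) e) U.* (mkℚᵘ (+ 1) 0 U.+ mkℚᵘ (+ 1) r)
  rhs = UP.≃-trans (QP.toℚᵘ-homo-* ((+ 2) / 1 Q.- inv (suc e)) ((+ 1) / 1 Q.+ inv (suc r)))
                   (UP.*-cong 2-1/e 1+1/r)

h[p*d]<bound : ∀ {p} → Prime p → ∀ k R → Deficient (p ^ k * R) →
  h (p * (p ^ k * R)) Q.< ((+ 2) / 1 Q.- inv (p ^ k * R)) Q.* ((+ 1) / 1 Q.+ inv (p ^ suc k ∸ 1))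
h[p*d]<bound {suc (suc p-2)} p-prime k R (d>0 , σd<2d) =
  subst (λ q → h (p * d) Q.< ((+ 2) / 1 Q.- inv d) Q.* ((+ 1) / 1 Q.+ inv q)) (sym q≡p-1*G)
        (ratio<bound (σ (p * d)) (p * d) d (p-1 * G) {{m*n≢0 p d}} {{d≢0}} {{m*n≢0 p-1 G}} cross-multiplied)
  where
  p-1 p d G c : ℕ
  p-1 = suc p-2
  p   = suc p-1
  d   = p ^ k * R
  G   = repunit p k
  c   = 2 * d ∸ 1
  instance
    d≢0 : NonZero d
    d≢0 = >-nonZero d>0
    R≢0 : NonZero R
    R≢0 = m*n≢0⇒n≢0 (p ^ k)
    G≢0 : NonZero G
    G≢0 = repunit≢0 p k
  q≡p-1*G : p ^ suc k ∸ 1 ≡ p-1 * G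
  q≡p-1*G = trans (cong (_∸ 1) (sym (repunit-geometric p-1 k))) (m+n∸n≡m (p-1 * G) 1)
  cross-multiplied : σ (p * d) * d * (p-1 * G) < c * suc (p-1 * G) * (p * d)
  cross-multiplied = begin-strict
    σ (p * d) * d * (p-1 * G)               ≡⟨ cong (λ x → x * d * (p-1 * G)) (σ-* p-prime d) ⟩
    (p * σ d + σ∤ p d) * d * (p-1 * G)      ≡⟨ *-CS.xy∙z≈xz∙y (p * σ d + σ∤ p d) d (p-1 * G) ⟩
    (p * σ d + σ∤ p d) * (p-1 * G) * d      <⟨ *-monoˡ-< d (cross-multiplied-bound p-1 (σ d) (σ∤ p d) G c
                                                 (σ∤*repunit≤σ p-prime k R) (σ>0 d) (∸-monoˡ-≤ 1 σd<2d)) ⟩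
    c * suc (p-1 * G) * p * d               ≡⟨ *-assoc (c * suc (p-1 * G)) p d ⟩
    c * suc (p-1 * G) * (p * d)             ∎
    where open ≤-Reasoning

mainTheorem7 : (N p₁ a₁ : ℕ) (rest : List (ℕ × ℕ)) →
    PrimitiveNonDeficient N →
    N ≡ p₁ ^ a₁ * primePowProd rest →
    Prime p₁ → All (λ pa → Prime (proj₁ pa)) rest →
    Unique (p₁ ∷ map proj₁ rest) →
    All (λ pa → 1 ≤ proj₂ pa) rest →
    2 ≤ a₁ →
    h N Q.< ((+ 2) / 1 Q.- inv (p₁ ^ (a₁ ∸ 1) * primePowProd rest))
            Q.* ((+ 1) / 1 Q.+ inv (p₁ ^ a₁ ∸ 1))
mainTheorem7 N p zero    rest _ _ _ _ _ _ ()
mainTheorem7 N p (suc k) rest (N>0 , _ , properDivisorsDeficient) N≡p^[1+k]*R p-prime _ _ _ _ =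
  subst (λ M → h M Q.< _) (sym N≡p*d) (h[p*d]<bound p-prime k R (properDivisorsDeficient d d∣N d<N))
  where
  R d : ℕ
  R = primePowProd rest
  d = p ^ k * R
  N≡p*d : N ≡ p * d
  N≡p*d = trans N≡p^[1+k]*R (*-assoc p (p ^ k) R)
  d∣N : d ∣ N
  d∣N = subst (d ∣_) (sym N≡p*d) (n∣m*n p)
  d<N : d < N
  d<N = subst (d <_) (trans (*-comm d p) (sym N≡p*d))
          (m<m*n d p {{m*n≢0⇒n≢0 p {{>-nonZero (subst (0 <_) N≡p*d N>0)}}}}
                     (nonTrivial⇒n>1 p {{prime⇒nonTrivial p-prime}}))
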